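{- Let $k$ be a field and $p,q,r,s$ nonnegative integers. Let $A=k[X]/(X^p)$, $B=k[Y]/(Y^q)$, let $x$ (resp. $y$) be the class of $X$ (resp. $Y$), identified with $x\otimes1$ (resp. $1\otimes y$) in $A\otimes_kB$, and let $u=x-y$. Then $x^ry^s$ is divisible by $u$ in $A\otimes_kB$ if and only if $r+s\ge\min\{p,q\}$. Moreover, the same statement holds if $u$ is replaced by any element of the form $cx+dy+(\text{terms of order at least }2 \text{ in } x,y)$ with $c,d$ nonzero elements of $k$. -}

module Defs where

open import Level using (Level; _⊔_) renaming (suc to lsuc)
open import Algebra.Bundles using (CommutativeRing)
open import Data.Nat using (ℕ; zero; suc; _∸_; _<_; _≟_)
open import Data.Product using (Σ; ∃; _×_; _,_)
open import Relation.Nullary using (¬_; yes; no)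

record Field (c ℓ : Level) : Set (lsuc (c ⊔ ℓ)) where
  field
    commutativeRing : CommutativeRing c ℓ
  open CommutativeRing commutativeRing public
  field
    0≉1     : ¬ (0# ≈ 1#)
    inverse : ∀ x → ¬ (x ≈ 0#) → Σ Carrier λ y → x * y ≈ 1#

module Truncated {c ℓ : Level} (k : Field c ℓ) (p q : ℕ) where
  open Field k using (Carrier; _≈_; _+_; _*_; _-_; 0#; 1#)

  -- An element of A ⊗_k B = k[X]/(X^p) ⊗_k k[Y]/(Y^q) ≅ k[X,Y]/(X^p, Y^q)
  -- is represented by its coefficient array  f i j = coefficient of x^i y^j.
  -- Coefficients with i ≥ p or j ≥ q are irrelevant (they are killed in
  -- the quotient); equality is equality of the coefficients with i < p, j < q.
  Elt : Set c
  Elt = ℕ → ℕ → Carrier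

  _≋_ : Elt → Elt → Set ℓ
  f ≋ g = ∀ i j → i < p → j < q → f i j ≈ g i j

  sumTo : ℕ → (ℕ → Carrier) → Carrier
  sumTo zero    g = g zero
  sumTo (suc n) g = sumTo n g + g (suc n)

  _⊗_ : Elt → Elt → Elt
  (f ⊗ g) i j = sumTo i λ a → sumTo j λ b → f a b * g (i ∸ a) (j ∸ b)

  mono : ℕ → ℕ → Elt
  mono r s i j with i ≟ r | j ≟ s
  ... | yes _ | yes _ = 1#
  ... | _     | _     = 0#

  x-y : Elt
  x-y i j = mono 1 0 i j - mono 0 1 i j

  _∣ᵗ_ : Elt → Elt → Set (c ⊔ ℓ)
  u ∣ᵗ v = ∃ λ w → (u ⊗ w) ≋ v

  IsLinearPlusHigher : Carrier → Carrier → Elt → Set ℓ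
  IsLinearPlusHigher cc dd u = (u 0 0 ≈ 0#) × (u 1 0 ≈ cc) × (u 0 1 ≈ dd)

module Submission where

open import Defs
open import Level using (Level)
open import Data.Nat using (ℕ; zero; suc; _+_; _∸_; _⊓_; _≤_; _<_; _≥_; z≤n; s≤s; _≟_)
import Data.Nat.Properties as ℕₚ
open import Data.Product using (Σ; _×_; _,_; proj₁; proj₂)
open import Data.Sum using (_⊎_; inj₁; inj₂)
open import Data.Empty using (⊥-elim)
open import Function.Base using (_∘_)
open import Function.Bundles using (_⇔_; mk⇔)
open import Relation.Nullary using (¬_; yes; no)
open import Relation.Binary.PropositionalEquality as ≡ using (_≡_)
import Algebra.Properties.CommutativeSemigroup as CommSemigroupProps
import Algebra.Properties.Group as GroupProps
import Relation.Binary.Reasoning.Setoid as SetoidReasoning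

-- Write u = ℓ + h with ℓ = c x + d y and h of order ≥ 2. If w has order ≥ m, then in
-- degrees ≤ m + 1 the coefficients of u w are those of ℓ w, and on the diagonal
-- i + j = m + 1 these read c w(i-1, j) + d w(i, j-1).
-- If u w = x^r y^s with r + s < min(p, q), every degree ≤ r + s lies inside the box
-- i < p, j < q, so degree by degree w has order ≥ r + s - 1; the equations on the
-- diagonal of degree r + s, solved from both ends, force the coefficient of x^r y^s to be 0.
-- Conversely, if v has order n ≥ min(p, q), one end of the diagonal of degree n lies
-- outside the box, so the equations ℓ w₀ = v on it can be solved one after another;
-- v - u w₀ has order n + 1, and an element of order p + q is 0.

degree-drop : ∀ {a b i j m} → a ≤ i → b ≤ j → 2 ≤ a + b → i + j ≤ suc m →
              (i ∸ a) + (j ∸ b) < m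
degree-drop {a} {b} {i} {j} {m} a≤i b≤j 2≤a+b deg = ℕₚ.≤-pred (begin
  suc (suc X)   ≡⟨ ℕₚ.+-comm 2 X ⟩
  X + 2         ≤⟨ ℕₚ.+-monoʳ-≤ X 2≤a+b ⟩
  X + (a + b)   ≡⟨ interchange (i ∸ a) (j ∸ b) a b ⟩
  (i ∸ a + a) + (j ∸ b + b) ≡⟨ ≡.cong₂ _+_ (ℕₚ.m∸n+n≡m a≤i) (ℕₚ.m∸n+n≡m b≤j) ⟩
  i + j         ≤⟨ deg ⟩
  suc m         ∎)
  where
  open ℕₚ.≤-Reasoning
  open CommSemigroupProps ℕₚ.+-commutativeSemigroup using (interchange)
  X = (i ∸ a) + (j ∸ b)

⊓≤⇒≤⊎≤ : ∀ {p q n} → p ⊓ q ≤ n → p ≤ n ⊎ q ≤ n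
⊓≤⇒≤⊎≤ {p} {q} h with ℕₚ.⊓-sel p q
... | inj₁ e = inj₁ (≡.subst (_≤ _) e h)
... | inj₂ e = inj₂ (≡.subst (_≤ _) e h)

module _ {o ℓ : Level} (k : Field o ℓ) where
  open Field k renaming (_+_ to _⊕_; _*_ to _⊙_; -_ to ⊝_)
  open SetoidReasoning setoid
  open GroupProps +-group using (\\-leftDividesˡ; ε⁻¹≈ε; ⁻¹-involutive)

  inv : ∀ x → ¬ x ≈ 0# → Carrier
  inv x x≉0 = proj₁ (inverse x x≉0)

  x*[x⁻¹*y]≈y : ∀ {x} (x≉0 : ¬ x ≈ 0#) y → x ⊙ (inv x x≉0 ⊙ y) ≈ y
  x*[x⁻¹*y]≈y {x} x≉0 y = begin
    x ⊙ (inv x x≉0 ⊙ y)  ≈⟨ *-assoc x _ y ⟨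
    (x ⊙ inv x x≉0) ⊙ y  ≈⟨ *-congʳ (proj₂ (inverse x x≉0)) ⟩
    1# ⊙ y               ≈⟨ *-identityˡ y ⟩
    y                    ∎

  x*y≈0⇒y≈0 : ∀ {x y} → ¬ x ≈ 0# → x ⊙ y ≈ 0# → y ≈ 0#
  x*y≈0⇒y≈0 {x} {y} x≉0 xy≈0 = begin
    y                        ≈⟨ x*[x⁻¹*y]≈y x≉0 y ⟨
    x ⊙ (inv x x≉0 ⊙ y)      ≈⟨ *-congˡ (*-comm _ y) ⟩
    x ⊙ (y ⊙ inv x x≉0)      ≈⟨ *-assoc x y _ ⟨
    (x ⊙ y) ⊙ inv x x≉0      ≈⟨ *-congʳ xy≈0 ⟩
    0# ⊙ inv x x≉0           ≈⟨ zeroˡ _ ⟩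
    0#                       ∎

  x+a*0≈x : ∀ {x a y} → y ≈ 0# → x ⊕ a ⊙ y ≈ x
  x+a*0≈x {x} {a} y≈0 = trans (+-congˡ (trans (*-congˡ y≈0) (zeroʳ a))) (+-identityʳ x)

  a*0+b*0≈0 : ∀ {a b x y} → x ≈ 0# → y ≈ 0# → a ⊙ x ⊕ b ⊙ y ≈ 0#
  a*0+b*0≈0 x≈0 y≈0 = trans (x+a*0≈x y≈0) (trans (*-congˡ x≈0) (zeroʳ _))

  1≉0 : ¬ 1# ≈ 0#
  1≉0 1≈0 = 0≉1 (sym 1≈0)

  -1≉0 : ¬ ⊝ 1# ≈ 0#
  -1≉0 -1≈0 = 1≉0 (trans (sym (⁻¹-involutive 1#)) (trans (-‿cong -1≈0) ε⁻¹≈ε))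

  Array : Set o
  Array = ℕ → ℕ → Carrier

  transpose : Array → Array
  transpose w i j = w j i

  shift : (ℕ → Carrier) → ℕ → Carrier
  shift f zero    = 0#
  shift f (suc n) = f n

  shiftˣ shiftʸ : Array → Array
  shiftˣ w i j = shift (λ i′ → w i′ j) i
  shiftʸ w i j = shift (w i) j

  shift-zero : ∀ {f} n → (∀ m → n ≡ suc m → f m ≈ 0#) → shift f n ≈ 0#
  shift-zero zero    _ = refl
  shift-zero (suc n) h = h n ≡.refl

  VanishesBelow : ℕ → Array → Set ℓ
  VanishesBelow m w = ∀ i j → i + j < m → w i j ≈ 0#

  shift-vanishesBelow : ∀ {m w} → VanishesBelow m w →
                        VanishesBelow (suc m) (shiftˣ w) × VanishesBelow (suc m) (shiftʸ w)
  shift-vanishesBelow {m} {w} w↓ = shiftˣ↓ , shiftʸ↓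
    where
    shiftˣ↓ : VanishesBelow (suc m) (shiftˣ w)
    shiftˣ↓ zero    j _   = refl
    shiftˣ↓ (suc i) j deg = w↓ i j (ℕₚ.≤-pred deg)
    shiftʸ↓ : VanishesBelow (suc m) (shiftʸ w)
    shiftʸ↓ i zero    _   = refl
    shiftʸ↓ i (suc j) deg = w↓ i j (ℕₚ.≤-pred (≡.subst (_< suc m) (ℕₚ.+-suc i j) deg))

  module LinearFormˣ (c d : Carrier) (c≉0 : ¬ c ≈ 0#) (d≉0 : ¬ d ≈ 0#) where

    linear⊗ : Array → Array
    linear⊗ w i j = c ⊙ shiftˣ w i j ⊕ d ⊙ shiftʸ w i j

    linear⊗-vanishesBelow : ∀ {m w} → VanishesBelow m w → VanishesBelow (suc m) (linear⊗ w)
    linear⊗-vanishesBelow w↓ i j deg =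
      a*0+b*0≈0 (proj₁ (shift-vanishesBelow w↓) i j deg) (proj₂ (shift-vanishesBelow w↓) i j deg)

    -- Induction on j: the equation at (i + 1, j) reads c w(i, j) + d w(i + 1, j - 1) = 0.
    vanish-from-xAxis : ∀ {w t n} →
      (∀ i j → j < t → suc i + j ≡ n → linear⊗ w (suc i) j ≈ 0#) →
      ∀ i j → j < t → suc i + j ≡ n → w i j ≈ 0#
    vanish-from-xAxis eqs i zero    j<t e = x*y≈0⇒y≈0 c≉0 (trans (sym (x+a*0≈x refl)) (eqs i 0 j<t e))
    vanish-from-xAxis {w} eqs i (suc j) j<t e = x*y≈0⇒y≈0 c≉0 (trans (sym (x+a*0≈x below)) (eqs i (suc j) j<t e))
      where
      below : w (suc i) j ≈ 0#
      below = vanish-from-xAxis eqs (suc i) j (ℕₚ.<-trans (ℕₚ.n<1+n j) j<t)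
                                (≡.trans (≡.cong suc (≡.sym (ℕₚ.+-suc i j))) e)

    diagonal : ℕ → (ℕ → Carrier) → Array
    diagonal m z i j with i + j ≟ m
    ... | yes _ = z i
    ... | no  _ = 0#

    diagonal-on : ∀ {m} z i j → i + j ≡ m → diagonal m z i j ≡ z i
    diagonal-on {m} z i j e with i + j ≟ m
    ... | yes _ = ≡.refl
    ... | no ne = ⊥-elim (ne e)

    diagonal-vanishesBelow : ∀ m z → VanishesBelow m (diagonal m z)
    diagonal-vanishesBelow m z i j deg with i + j ≟ m
    ... | yes e = ⊥-elim (ℕₚ.<⇒≢ deg e)
    ... | no  _ = refl

    -- Since the point (m + 1, 0) is excluded, the equations can be solved one after
    -- another starting from the y-axis, dividing by d each time.
    solve-diagonal : ∀ {p} m (v : Array) → p ≤ suc m →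
      Σ Array λ w → VanishesBelow m w ×
                    (∀ i j → i + j ≡ suc m → i < p → linear⊗ w i j ≈ v i j)
    solve-diagonal {p} m v p≤ = diagonal m z , diagonal-vanishesBelow m z , solves
      where
      z : ℕ → Carrier
      z zero    = inv d d≉0 ⊙ v 0 (suc m)
      z (suc i) = inv d d≉0 ⊙ (⊝ (c ⊙ z i) ⊕ v (suc i) (m ∸ i))

      solves : ∀ i j → i + j ≡ suc m → i < p → linear⊗ (diagonal m z) i j ≈ v i j
      solves zero (suc j) e _ = begin
        c ⊙ 0# ⊕ d ⊙ diagonal m z 0 j ≈⟨ +-cong (zeroʳ c)
                                                 (*-congˡ (reflexive (diagonal-on z 0 j (ℕₚ.suc-injective e)))) ⟩
        0# ⊕ d ⊙ z 0                  ≈⟨ +-identityˡ _ ⟩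
        d ⊙ z 0                       ≈⟨ x*[x⁻¹*y]≈y d≉0 _ ⟩
        v 0 (suc m)                   ≡⟨ ≡.cong (v 0) (≡.sym e) ⟩
        v 0 (suc j)                   ∎
      solves (suc i) zero e i<p =
        ⊥-elim (ℕₚ.<-irrefl ≡.refl
          (ℕₚ.<-≤-trans i<p (≡.subst (p ≤_) (≡.trans (≡.sym e) (ℕₚ.+-identityʳ _)) p≤)))
      solves (suc i) (suc j) e _ = begin
        c ⊙ diagonal m z i (suc j) ⊕ d ⊙ diagonal m z (suc i) j
          ≈⟨ +-cong (*-congˡ (reflexive (diagonal-on z i (suc j) i+j′≡m)))
                    (*-congˡ (reflexive (diagonal-on z (suc i) j i′+j≡m))) ⟩
        c ⊙ z i ⊕ d ⊙ z (suc i)                ≈⟨ +-congˡ (x*[x⁻¹*y]≈y d≉0 _) ⟩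
        c ⊙ z i ⊕ (⊝ (c ⊙ z i) ⊕ v (suc i) (m ∸ i)) ≈⟨ \\-leftDividesˡ _ _ ⟩
        v (suc i) (m ∸ i)                      ≡⟨ ≡.cong (v (suc i)) m∸i≡j′ ⟩
        v (suc i) (suc j)                      ∎
        where
        i+j′≡m : i + suc j ≡ m
        i+j′≡m = ℕₚ.suc-injective e
        i′+j≡m : suc i + j ≡ m
        i′+j≡m = ≡.trans (≡.sym (ℕₚ.+-suc i j)) i+j′≡m
        m∸i≡j′ : m ∸ i ≡ suc j
        m∸i≡j′ = ≡.trans (≡.cong (_∸ i) (≡.sym i+j′≡m)) (ℕₚ.m+n∸m≡n i (suc j))

  -- The y-axis versions are the x-axis ones for the transposed array and the form d x + c y.
  module LinearForm (c d : Carrier) (c≉0 : ¬ c ≈ 0#) (d≉0 : ¬ d ≈ 0#) where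
    open LinearFormˣ c d c≉0 d≉0 public
    private module Swapped = LinearFormˣ d c d≉0 c≉0

    linear⊗-transpose : ∀ w i j → Swapped.linear⊗ (transpose w) j i ≈ linear⊗ w i j
    linear⊗-transpose w i j = +-comm _ _

    vanish-from-yAxis : ∀ {w t n} →
      (∀ i j → i < t → i + suc j ≡ n → linear⊗ w i (suc j) ≈ 0#) →
      ∀ i j → i < t → i + suc j ≡ n → w i j ≈ 0#
    vanish-from-yAxis {w} eqs i j i<t e =
      Swapped.vanish-from-xAxis {transpose w}
        (λ j′ i′ i′<t e′ → trans (linear⊗-transpose w i′ (suc j′))
                                 (eqs i′ j′ i′<t (≡.trans (ℕₚ.+-comm i′ (suc j′)) e′)))
        j i i<t (≡.trans (ℕₚ.+-comm (suc j) i) e)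

    solve-diagonalᵀ : ∀ {q} m (v : Array) → q ≤ suc m →
      Σ Array λ w → VanishesBelow m w ×
                    (∀ i j → i + j ≡ suc m → j < q → linear⊗ w i j ≈ v i j)
    solve-diagonalᵀ m v q≤ with Swapped.solve-diagonal m (transpose v) q≤
    ... | w , w↓ , solves =
      transpose w ,
      (λ i j deg → w↓ j i (≡.subst (_< m) (ℕₚ.+-comm i j) deg)) ,
      λ i j e j<q → trans (sym (linear⊗-transpose (transpose w) i j))
                          (solves j i (≡.trans (ℕₚ.+-comm j i) e) j<q)

  module _ (p q : ℕ) where
    open Truncated k p q

    sumTo-cong : ∀ n {f g} → (∀ a → a ≤ n → f a ≈ g a) → sumTo n f ≈ sumTo n g
    sumTo-cong zero    f≈g = f≈g 0 z≤n
    sumTo-cong (suc n) f≈g =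
      +-cong (sumTo-cong n (λ a a≤n → f≈g a (ℕₚ.m≤n⇒m≤1+n a≤n))) (f≈g (suc n) ℕₚ.≤-refl)

    sumTo-zero : ∀ n {f} → (∀ a → a ≤ n → f a ≈ 0#) → sumTo n f ≈ 0#
    sumTo-zero zero    f≈0 = f≈0 0 z≤n
    sumTo-zero (suc n) f≈0 =
      trans (+-cong (sumTo-zero n (λ a a≤n → f≈0 a (ℕₚ.m≤n⇒m≤1+n a≤n))) (f≈0 (suc n) ℕₚ.≤-refl))
            (+-identityʳ 0#)

    sumTo-+ : ∀ n f g → sumTo n (λ a → f a ⊕ g a) ≈ sumTo n f ⊕ sumTo n g
    sumTo-+ zero    f g = refl
    sumTo-+ (suc n) f g = trans (+-congʳ (sumTo-+ n f g)) (interchange _ _ _ _)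
      where open CommSemigroupProps +-commutativeSemigroup using (interchange)

    sumTo-suc : ∀ n f → sumTo (suc n) f ≈ f 0 ⊕ sumTo n (f ∘ suc)
    sumTo-suc zero    f = refl
    sumTo-suc (suc n) f = trans (+-congʳ (sumTo-suc n f)) (+-assoc _ _ _)

    sumTo-head : ∀ n f → (∀ a → a < n → f (suc a) ≈ 0#) → sumTo n f ≈ f 0
    sumTo-head zero    f _    = refl
    sumTo-head (suc n) f tail = trans (sumTo-suc n f)
      (trans (+-congˡ (sumTo-zero n (λ a a≤n → tail a (s≤s a≤n)))) (+-identityʳ _))

    sumTo-first-two : ∀ n f → (∀ a → a < n → f (suc (suc a)) ≈ 0#) → sumTo (suc n) f ≈ f 0 ⊕ f 1
    sumTo-first-two n f tail = trans (sumTo-suc n f) (+-congˡ (sumTo-head n (f ∘ suc) tail))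

    ⊗-distribˡ : ∀ u w₁ w₂ i j →
                 (u ⊗ (λ x y → w₁ x y ⊕ w₂ x y)) i j ≈ (u ⊗ w₁) i j ⊕ (u ⊗ w₂) i j
    ⊗-distribˡ u w₁ w₂ i j =
      trans (sumTo-cong i (λ a _ → trans (sumTo-cong j (λ b _ → distribˡ _ _ _)) (sumTo-+ j _ _)))
            (sumTo-+ i _ _)

    ⊗-zeroʳ : ∀ u i j → (u ⊗ (λ _ _ → 0#)) i j ≈ 0#
    ⊗-zeroʳ u i j = sumTo-zero i (λ a _ → sumTo-zero j (λ b _ → zeroʳ _))

    mono-off : ∀ {r s} i j → ¬ (i ≡ r × j ≡ s) → mono r s i j ≡ 0#
    mono-off {r} {s} i j ne with i ≟ r | j ≟ s
    ... | yes i≡r | yes j≡s = ⊥-elim (ne (i≡r , j≡s))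
    ... | yes _   | no _    = ≡.refl
    ... | no _    | _       = ≡.refl

    mono-on : ∀ r s → mono r s r s ≡ 1#
    mono-on r s with r ≟ r | s ≟ s
    ... | yes _ | yes _ = ≡.refl
    ... | no ne | _     = ⊥-elim (ne ≡.refl)
    ... | yes _ | no ne = ⊥-elim (ne ≡.refl)

    mono-vanishesBelow : ∀ r s → VanishesBelow (r + s) (mono r s)
    mono-vanishesBelow r s i j deg =
      reflexive (mono-off i j (λ (i≡r , j≡s) → ℕₚ.<⇒≢ deg (≡.cong₂ _+_ i≡r j≡s)))

    in-box : ∀ {i j n} → i + j ≤ n → n < p ⊓ q → i < p × j < q
    in-box {i} {j} deg n<min =
      ℕₚ.m<n⊓o⇒m<n p q (ℕₚ.≤-<-trans (ℕₚ.≤-trans (ℕₚ.m≤m+n i j) deg) n<min) ,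
      ℕₚ.m<n⊓o⇒m<o p q (ℕₚ.≤-<-trans (ℕₚ.≤-trans (ℕₚ.m≤n+m j i) deg) n<min)

    VanishesBelowᵗ : ℕ → Elt → Set ℓ
    VanishesBelowᵗ m v = ∀ i j → i + j < m → i < p → j < q → v i j ≈ 0#

    module Divisibility (c d : Carrier) (u : Elt) (c≉0 : ¬ c ≈ 0#) (d≉0 : ¬ d ≈ 0#)
                        (u-linear : IsLinearPlusHigher c d u) where
      open LinearForm c d c≉0 d≉0

      term-vanishes : ∀ {m w a b i j} → VanishesBelow m w →
                      a ≤ i → b ≤ j → 2 ≤ a + b → i + j ≤ suc m →
                      u a b ⊙ w (i ∸ a) (j ∸ b) ≈ 0#
      term-vanishes w↓ a≤i b≤j 2≤a+b deg =
        trans (*-congˡ (w↓ _ _ (degree-drop a≤i b≤j 2≤a+b deg))) (zeroʳ _)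

      pure-y-part : ∀ {m w} i j → VanishesBelow m w → i + j ≤ suc m →
                    sumTo j (λ b → u 0 b ⊙ w i (j ∸ b)) ≈ d ⊙ shiftʸ w i j
      pure-y-part i zero    _  _   = trans (trans (*-congʳ (proj₁ u-linear)) (zeroˡ _)) (sym (zeroʳ d))
      pure-y-part {w = w} i (suc j) w↓ deg = begin
        sumTo (suc j) (λ b → u 0 b ⊙ w i (suc j ∸ b))  ≈⟨ sumTo-first-two j _ (λ b b<j →
                                                            term-vanishes w↓ z≤n (s≤s b<j) (s≤s (s≤s z≤n)) deg) ⟩
        u 0 0 ⊙ w i (suc j) ⊕ u 0 1 ⊙ w i j            ≈⟨ +-cong (trans (*-congʳ (proj₁ u-linear)) (zeroˡ _))
                                                                 (*-congʳ (proj₂ (proj₂ u-linear))) ⟩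
        0# ⊕ d ⊙ w i j                                 ≈⟨ +-identityˡ _ ⟩
        d ⊙ shiftʸ w i (suc j)                         ∎

      ⊗-leading : ∀ {m w} i j → VanishesBelow m w → i + j ≤ suc m → (u ⊗ w) i j ≈ linear⊗ w i j
      ⊗-leading zero j w↓ deg = trans (pure-y-part 0 j w↓ deg) (sym (trans (+-congʳ (zeroʳ c)) (+-identityˡ _)))
      ⊗-leading {w = w} (suc i) j w↓ deg = begin
        sumTo (suc i) row                   ≈⟨ sumTo-first-two i row (λ a a<i → sumTo-zero j (λ b b≤j →
                                                 term-vanishes w↓ (s≤s a<i) b≤j (s≤s (s≤s z≤n)) deg)) ⟩
        row 0 ⊕ row 1                       ≈⟨ +-cong (pure-y-part (suc i) j w↓ deg) x-part ⟩
        d ⊙ shiftʸ w (suc i) j ⊕ c ⊙ w i j  ≈⟨ +-comm _ _ ⟩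
        linear⊗ w (suc i) j                 ∎
        where
        row : ℕ → Carrier
        row a = sumTo j (λ b → u a b ⊙ w (suc i ∸ a) (j ∸ b))
        x-part : row 1 ≈ c ⊙ w i j
        x-part = trans (sumTo-head j _ (λ b b<j → term-vanishes w↓ (s≤s z≤n) b<j (s≤s (s≤s z≤n)) deg))
                       (*-congʳ (proj₁ (proj₂ u-linear)))

      order-step : ∀ {w} m → suc m < p ⊓ q → VanishesBelowᵗ (suc (suc m)) (u ⊗ w) →
                   VanishesBelow m w → VanishesBelow (suc m) w
      order-step {w} m m+1<min uw↓ w↓ i j deg with ℕₚ.m≤n⇒m<n∨m≡n (ℕₚ.≤-pred deg)
      ... | inj₁ lt = w↓ i j lt
      ... | inj₂ e  = vanish-from-xAxis equations i j
                        (s≤s (≡.subst (j ≤_) e (ℕₚ.m≤n+m j i))) (≡.cong suc e)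
        where
        equations : ∀ i j → j < suc m → suc i + j ≡ suc m → linear⊗ w (suc i) j ≈ 0#
        equations i j _ e = trans (sym (⊗-leading (suc i) j w↓ (ℕₚ.≤-reflexive e)))
          (uw↓ (suc i) j (s≤s (ℕₚ.≤-reflexive e)) (proj₁ box) (proj₂ box))
          where box = in-box (ℕₚ.≤-reflexive e) m+1<min

      order-of-quotient : ∀ {w} n → n < p ⊓ q → VanishesBelowᵗ n (u ⊗ w) → VanishesBelow (n ∸ 1) w
      order-of-quotient zero                _      _   _ _ ()
      order-of-quotient (suc zero)          _      _   _ _ ()
      order-of-quotient (suc (suc m)) n<min uw↓ =
        order-step m (ℕₚ.<-trans (ℕₚ.n<1+n _) n<min) uw↓
          (order-of-quotient (suc m) (ℕₚ.<-trans (ℕₚ.n<1+n _) n<min) (λ i j deg → uw↓ i j (ℕₚ.m<n⇒m<1+n deg)))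

      not-divides : ∀ r s → r + s < p ⊓ q → ¬ (u ∣ᵗ mono r s)
      not-divides r s n<min (w , uw≋rs) = 0≉1 (begin
        0#             ≈⟨ a*0+b*0≈0 shiftˣ-zero shiftʸ-zero ⟨
        linear⊗ w r s  ≈⟨ equation r s ≡.refl ⟩
        mono r s r s   ≡⟨ mono-on r s ⟩
        1#             ∎)
        where
        w↓ : VanishesBelow (r + s ∸ 1) w
        w↓ = order-of-quotient (r + s) n<min (λ i j deg i<p j<q →
               trans (uw≋rs i j i<p j<q) (mono-vanishesBelow r s i j deg))
        equation : ∀ i j → i + j ≡ r + s → linear⊗ w i j ≈ mono r s i j
        equation i j e = trans (sym (⊗-leading i j w↓ deg)) (uw≋rs i j (proj₁ box) (proj₂ box))
          where
          deg = ≡.subst (_≤ suc (r + s ∸ 1)) (≡.sym e) (ℕₚ.m≤n+m∸n (r + s) 1)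
          box = in-box (ℕₚ.≤-reflexive e) n<min
        below-s : ∀ i j → j < s → suc i + j ≡ r + s → w i j ≈ 0#
        below-s = vanish-from-xAxis λ i j j<s e →
          trans (equation (suc i) j e) (reflexive (mono-off {r} (suc i) j λ (_ , j≡s) → ℕₚ.<⇒≢ j<s j≡s))
        left-of-r : ∀ i j → i < r → i + suc j ≡ r + s → w i j ≈ 0#
        left-of-r = vanish-from-yAxis λ i j i<r e →
          trans (equation i (suc j) e) (reflexive (mono-off {r} i (suc j) λ (i≡r , _) → ℕₚ.<⇒≢ i<r i≡r))
        shiftˣ-zero : shiftˣ w r s ≈ 0#
        shiftˣ-zero = shift-zero r λ r′ e →
          left-of-r r′ s (≡.subst (r′ <_) (≡.sym e) ℕₚ.≤-refl) (≡.trans (ℕₚ.+-suc r′ s) (≡.cong (_+ s) (≡.sym e)))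
        shiftʸ-zero : shiftʸ w r s ≈ 0#
        shiftʸ-zero = shift-zero s λ s′ e →
          below-s r s′ (≡.subst (s′ <_) (≡.sym e) ℕₚ.≤-refl) (≡.trans (≡.sym (ℕₚ.+-suc r s′)) (≡.cong (r +_) (≡.sym e)))

      solve-diagonal-in-box : ∀ m (v : Elt) → p ⊓ q ≤ suc m →
        Σ Array λ w → VanishesBelow m w × (∀ i j → i + j ≡ suc m → i < p → j < q → linear⊗ w i j ≈ v i j)
      solve-diagonal-in-box m v min≤ with ⊓≤⇒≤⊎≤ min≤
      ... | inj₁ p≤ = let w , w↓ , solves = solve-diagonal m v p≤ in
                      w , w↓ , λ i j e i<p _ → solves i j e i<p
      ... | inj₂ q≤ = let w , w↓ , solves = solve-diagonalᵀ m v q≤ in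
                      w , w↓ , λ i j e _ j<q → solves i j e j<q

      raise-order : ∀ m v → p ⊓ q ≤ suc m → VanishesBelowᵗ (suc m) v →
        Σ Array λ w → VanishesBelowᵗ (suc (suc m)) (λ i j → ⊝ (u ⊗ w) i j ⊕ v i j)
      raise-order m v min≤ v↓ with solve-diagonal-in-box m v min≤
      ... | w , w↓ , solves = w , λ i j deg i<p j<q →
              trans (+-congˡ (sym (agrees i j deg i<p j<q))) (-‿inverseˡ _)
        where
        agrees : ∀ i j → i + j < suc (suc m) → i < p → j < q → (u ⊗ w) i j ≈ v i j
        agrees i j deg i<p j<q with ℕₚ.m≤n⇒m<n∨m≡n (ℕₚ.≤-pred deg)
        ... | inj₁ lt = trans (⊗-leading i j w↓ (ℕₚ.<⇒≤ lt))
                              (trans (linear⊗-vanishesBelow w↓ i j lt) (sym (v↓ i j lt i<p j<q)))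
        ... | inj₂ e  = trans (⊗-leading i j w↓ (ℕₚ.≤-reflexive e)) (solves i j e i<p j<q)

      -- Downward induction on n, with t ≥ p + q - n steps left; once n ≥ p + q, v ≋ 0.
      divides-above : ∀ t n → p ⊓ q ≤ n → p + q ≤ t + n → ∀ v → VanishesBelowᵗ n v → u ∣ᵗ v
      divides-above zero n _ p+q≤n v v↓ = (λ _ _ → 0#) , λ i j i<p j<q →
        trans (⊗-zeroʳ u i j) (sym (v↓ i j (ℕₚ.<-≤-trans (ℕₚ.+-mono-< i<p j<q) p+q≤n) i<p j<q))
      divides-above (suc t) zero min≤0 _ v _ = (λ _ _ → 0#) , λ i j i<p j<q →
        ⊥-elim (ℕₚ.1+n≰n (ℕₚ.≤-trans (ℕₚ.⊓-glb (ℕₚ.≤-trans (s≤s z≤n) i<p) (ℕₚ.≤-trans (s≤s z≤n) j<q))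
                                      min≤0))
      divides-above (suc t) (suc m) min≤ p+q≤ v v↓ with raise-order m v min≤ v↓
      ... | w₀ , residual↓ with divides-above t (suc (suc m)) (ℕₚ.m≤n⇒m≤1+n min≤)
                                 (≡.subst (p + q ≤_) (≡.sym (ℕₚ.+-suc t (suc m))) p+q≤) _ residual↓
      ... | w₁ , uw₁≋residual = (λ x y → w₀ x y ⊕ w₁ x y) , λ i j i<p j<q → begin
        (u ⊗ (λ x y → w₀ x y ⊕ w₁ x y)) i j  ≈⟨ ⊗-distribˡ u w₀ w₁ i j ⟩
        (u ⊗ w₀) i j ⊕ (u ⊗ w₁) i j          ≈⟨ +-congˡ (uw₁≋residual i j i<p j<q) ⟩
        (u ⊗ w₀) i j ⊕ (⊝ (u ⊗ w₀) i j ⊕ v i j) ≈⟨ \\-leftDividesˡ _ _ ⟩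
        v i j                                ∎

      divides-mono⇔ : ∀ r s → (u ∣ᵗ mono r s) ⇔ (r + s ≥ p ⊓ q)
      divides-mono⇔ r s = mk⇔
        (λ u∣rs → ℕₚ.≮⇒≥ λ n<min → not-divides r s n<min u∣rs)
        (λ min≤n → divides-above (p + q) (r + s) min≤n (ℕₚ.m≤m+n (p + q) (r + s)) (mono r s)
                     (λ i j deg _ _ → mono-vanishesBelow r s i j deg))

    x-y-isLinear : IsLinearPlusHigher 1# (⊝ 1#) x-y
    x-y-isLinear = -‿inverseʳ 0# , trans (+-congˡ ε⁻¹≈ε) (+-identityʳ 1#) , +-identityˡ (⊝ 1#)

lemma3 : ∀ {c ℓ : Level} (k : Field c ℓ) (p q r s : ℕ) →
    ((Truncated._∣ᵗ_ k p q (Truncated.x-y k p q) (Truncated.mono k p q r s))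
       ⇔ (r + s ≥ p ⊓ q))
    × (∀ (cc dd : Field.Carrier k) (u : Truncated.Elt k p q) →
         ¬ (Field._≈_ k cc (Field.0# k)) → ¬ (Field._≈_ k dd (Field.0# k)) →
         Truncated.IsLinearPlusHigher k p q cc dd u →
         ((Truncated._∣ᵗ_ k p q u (Truncated.mono k p q r s)) ⇔ (r + s ≥ p ⊓ q)))
lemma3 k p q r s =
  Divisibility.divides-mono⇔ k p q _ _ (Truncated.x-y k p q) (1≉0 k) (-1≉0 k) (x-y-isLinear k p q) r s ,
  λ c d u c≉0 d≉0 u-linear → Divisibility.divides-mono⇔ k p q c d u c≉0 d≉0 u-linear r s
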